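{- Let $(X,\mathcal{B})$ be a simple $(v,k,\lambda)$-BIBD, let $M$ be its incidence matrix, and let $n$ be the rank of $M$ over $\mathbb{F}_2$. Then the complementary design of $\mathrm{PG}(n-1,2)$ is, up to isomorphism, the only BIBD for which $\mathcal{B} \cup \{\emptyset\}$ is a group under the symmetric difference $\Delta$; that is, $\mathcal{B}\cup\{\emptyset\}$ is closed under $\Delta$ if and only if $(X,\mathcal{B})$ is isomorphic to the complementary design of $\mathrm{PG}(n-1,2)$.
   Context: A simple $(v,k,\lambda)$-BIBD is a pair $(X,\mathcal{B})$ where $X$ is a finite set of $v$ points and $\mathcal{B}$ is a set of (pairwise distinct) subsets of $X$, called blocks, each containing exactly $k$ points, such that every pair of distinct points is contained in exactly $\lambda$ blocks; it is required that $v > k \geq 2$. Writing $X=\{x_1,\dots,x_v\}$ and $\mathcal{B}=\{B_1,\dots,B_b\}$, the incidence matrix is the $v\times b$ matrix $M=(m_{i,j})$ with $m_{i,j}=1$ if $x_i\in B_j$ and $0$ otherwise, with rank computed over $\mathbb{F}_2$. $B \Delta C = (B\setminus C)\cup(C\setminus B)$. The design $\mathrm{PG}(n-1,2)$ has as points the $2^n-1$ nonzero vectors of $\mathbb{F}_2^n$ (the points of the projective space of dimension $n-1$ over $\mathbb{F}_2$) and as blocks its hyperplanes (the nonzero vectors of the $(n-1)$-dimensional subspaces); its complementary design has the same points and as blocks the complements of these hyperplanes, giving a symmetric $(2^n-1,2^{n-1},2^{n-2})$-design. Two designs are isomorphic if there is a bijection between their point sets mapping the set of blocks of one onto the set of blocks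 of the other. -}

module Defs where

open import Data.Nat using (ℕ; zero; suc; _<_; _≤_)
open import Data.Bool using (Bool; true; false; _xor_; _∧_)
open import Data.Fin using (Fin; zero; suc)
open import Data.Vec using (Vec; lookup; zipWith; replicate)
open import Data.Fin.Subset using (Subset; _∈_; ∣_∣; ⊥)
open import Data.List using (List; length; filter; allFin)
open import Data.List.Base using (map)
open import Data.Product using (Σ; ∃; ∃-syntax; _×_; _,_)
open import Data.Sum using (_⊎_)
open import Function.Bundles using (_⇔_)
open import Function.Definitions using (Injective)
open import Relation.Binary.PropositionalEquality using (_≡_; _≢_)
open import Relation.Nullary using (¬_)
open import Relation.Nullary.Decidable using (_×-dec_)
open import Data.Fin.Subset.Properties using (_∈?_)

⊕-sum : {r : ℕ} → (Fin r → Bool) → Bool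
⊕-sum {zero}  f = false
⊕-sum {suc r} f = f zero xor ⊕-sum (λ i → f (suc i))

dot : {n : ℕ} → Vec Bool n → Vec Bool n → Bool
dot a x = ⊕-sum (λ i → lookup a i ∧ lookup x i)

Matrix : ℕ → ℕ → Set
Matrix m p = Fin m → Fin p → Bool

LinIndep : {m r : ℕ} → (Fin r → Fin m → Bool) → Set
LinIndep {m} {r} f =
  (c : Fin r → Bool) →
  (∀ (i : Fin m) → ⊕-sum (λ l → c l ∧ f l i) ≡ false) →
  ∀ (l : Fin r) → c l ≡ false

column : {m p : ℕ} → Matrix m p → Fin p → Fin m → Bool
column M j i = M i j

RankF2 : {m p : ℕ} → Matrix m p → ℕ → Set
RankF2 {m} {p} M n =
  (Σ (Fin n → Fin p) λ g → LinIndep {m} {n} (λ l → column M (g l)))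
  × (∀ (g : Fin (suc n) → Fin p) → ¬ LinIndep {m} {suc n} (λ l → column M (g l)))

-- Designs.  Points are Fin v; the blocks are an injectively indexed
-- family B : Fin b → Subset v (so the blocks are pairwise distinct).

pairCount : {v b : ℕ} → (Fin b → Subset v) → Fin v → Fin v → ℕ
pairCount {v} {b} B x y =
  length (filter (λ j → (x ∈? B j) ×-dec (y ∈? B j)) (allFin b))

record IsSimpleBIBD (v k lam b : ℕ) (B : Fin b → Subset v) : Set where
  field
    k<v       : k < v
    2≤k       : 2 ≤ k
    1≤λ       : 1 ≤ lam
    simple    : Injective _≡_ _≡_ B
    blockSize : ∀ (j : Fin b) → ∣ B j ∣ ≡ k
    balanced  : ∀ (x y : Fin v) → x ≢ y → pairCount B x y ≡ lam

incidence : {v b : ℕ} → (Fin b → Subset v) → Matrix v b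
incidence B i j = lookup (B j) i

_Δ_ : {v : ℕ} → Subset v → Subset v → Subset v
P Δ Q = zipWith _xor_ P Q

ClosedUnderΔ : {v b : ℕ} → (Fin b → Subset v) → Set
ClosedUnderΔ {v} {b} B =
  ∀ (i j : Fin b) → (B i Δ B j ≡ ⊥) ⊎ (∃[ l ] (B i Δ B j ≡ B l))

-- The complementary design of PG(n-1,2).
-- Points: nonzero vectors of F₂ⁿ.  Hyperplanes: H_a = {x ≠ 0 : a·x = 0}
-- for a ≠ 0; complement blocks: C_a = {x ≠ 0 : a·x = 1}.

nonzero : {n : ℕ} → Vec Bool n → Set
nonzero {n} x = x ≢ replicate n false

IsoCompPG : {v b : ℕ} → (Fin b → Subset v) → ℕ → Set
IsoCompPG {v} {b} B n =
  Σ (Fin v → Vec Bool n) λ φ →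
      (∀ (x : Fin v) → nonzero (φ x))
    × Injective _≡_ _≡_ φ
    × (∀ (y : Vec Bool n) → nonzero y → ∃[ x ] (φ x ≡ y))
    × (∀ (j : Fin b) → ∃[ a ] (nonzero a ×
          (∀ (x : Fin v) → (x ∈ B j) ⇔ (dot a (φ x) ≡ true))))
    × (∀ (a : Vec Bool n) → nonzero a → ∃[ j ]
          (∀ (x : Fin v) → (x ∈ B j) ⇔ (dot a (φ x) ≡ true)))

-- Given closure, take columns B(g 1), …, B(g n) of the incidence matrix forming a basis of its column space
-- over F₂, and send a point x to φ x = (x ∈ B(g l))ₗ ∈ F₂ⁿ. Maximality of the basis writes every block as a
-- combination Σ aₗ B(g l), i.e. as {x : a·φ x = 1} with a ≠ 0, and closure under Δ makes every nonzero a
-- occur. Since every point lies in a block, φ avoids 0; since two points lying in the same blocks would give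
-- two pairs with different pair counts, φ is injective. Finally the image of φ meets every complement
-- {a·y = 1} of a hyperplane in exactly k points, and a subset of F₂ᵐ with that property contains either all
-- nonzero vectors or none (induction on m, splitting by the first coordinate), so φ is onto F₂ⁿ ∖ {0}.
-- Conversely, the sets {a·y = 1} together with ∅ are closed under Δ because a·y is linear in a.

module Submission where

open import Defs
open import Algebra.Bundles using (CommutativeRing)
open import Algebra.Properties.CommutativeSemigroup as CommutativeSemigroupProperties using ()
open import Data.Bool using (Bool; true; false; not; _∧_; _∨_; _xor_)
open import Data.Bool.Properties
  using (∧-zeroʳ; ∧-identityʳ; not-involutive; ∧-distribʳ-xor; xor-identityʳ; xor-∧-commutativeRing)
  renaming (_≟_ to _≟ᵇ_)
open import Data.Empty using (⊥-elim)
open import Data.Fin using (Fin; zero; suc; fromℕ<)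
open import Data.Fin.Properties using (any?; all?; suc-injective; 0≢1+n; ¬∀⟶∃¬) renaming (_≟_ to _≟ᶠ_)
open import Data.Fin.Subset using (Subset; _∈_; _∉_; ∣_∣; ⊥; ⊤; Nonempty)
open import Data.Fin.Subset.Properties
  using (_∈?_; ∣⊥∣≡0; ∣⊤∣≡n; p⊆q⇒∣p∣≤∣q∣; nonempty?; Empty-unique; anySubset?)
open import Data.List using (List; []; _∷_; length; filter; allFin)
open import Data.List.Membership.Propositional using () renaming (_∈_ to _∈ₗ_)
open import Data.List.Membership.Propositional.Properties using (∈-filter⁺; ∈-filter⁻; ∈-allFin)
open import Data.List.Relation.Binary.Pointwise using (Pointwise-≡⇒≡)
open import Data.List.Relation.Binary.Sublist.Propositional using (⊆-refl)
open import Data.List.Relation.Binary.Sublist.Propositional.Properties using (filter⁺; to-≋)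
open import Data.List.Relation.Unary.Any using (here)
open import Data.Nat using (ℕ; zero; suc; _+_; _≤_; _<_; ⌊_/2⌋; z≤n; s≤s)
open import Data.Nat.Properties
  using (+-comm; +-assoc; +-identityʳ; +-cancelˡ-≡; +-cancelʳ-≡; m≤m+n; m≤n+m; ≤-refl; ≤-trans;
         <⇒≤; <⇒≱; n>0⇒n≢0; n≡⌊n+n/2⌋; +-commutativeSemigroup)
open import Data.Product using (∃; _×_; _,_; proj₁; proj₂)
open import Data.Sum as Sum using (_⊎_; inj₁; inj₂)
open import Data.Vec using (Vec; []; _∷_; lookup; tabulate; replicate; there)
open import Data.Vec.Properties
  using (≡-dec; lookup-zipWith; lookup-replicate; lookup∘tabulate; tabulate∘lookup; tabulate-cong; []=⇒lookup; lookup⇒[]=)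
import Data.Vec.Functional as Vector
open import Function using (_∘_; const)
open import Function.Bundles using (_⇔_; mk⇔; Equivalence)
open import Function.Definitions using (Injective)
open import Relation.Binary.Definitions using (DecidableEquality)
open import Relation.Binary.PropositionalEquality
  using (_≡_; _≢_; refl; sym; trans; cong; cong₂; subst; subst₂; module ≡-Reasoning)
open import Relation.Nullary using (¬_; Dec; yes; no; does)
open import Relation.Nullary.Decidable using (dec-true; _×-dec_)
open import Relation.Unary using (Decidable)

open ≡-Reasoning

lookup-extensionality : ∀ {A : Set} {n} {xs ys : Vec A n} → (∀ i → lookup xs i ≡ lookup ys i) → xs ≡ ys
lookup-extensionality {xs = xs} {ys} eq =
  trans (sym (tabulate∘lookup xs)) (trans (tabulate-cong eq) (tabulate∘lookup ys))

lookup-Δ : ∀ {v} (P Q : Subset v) x → lookup (P Δ Q) x ≡ lookup P x xor lookup Q x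
lookup-Δ P Q x = lookup-zipWith _xor_ x P Q

xor≡false⇒≡ : ∀ {a b} → a xor b ≡ false → a ≡ b
xor≡false⇒≡ {false} {false} _ = refl
xor≡false⇒≡ {true}  {true}  _ = refl

lookup≡⇒∈⇔ : ∀ {v} {x : Fin v} {S : Subset v} {b} → lookup S x ≡ b → (x ∈ S) ⇔ (b ≡ true)
lookup≡⇒∈⇔ {x = x} {S} S[x]≡b =
  mk⇔ (λ x∈S → trans (sym S[x]≡b) ([]=⇒lookup x∈S)) (λ b≡true → lookup⇒[]= x S (trans S[x]≡b b≡true))

∈⇔⇒lookup≡ : ∀ {v} {x : Fin v} {S : Subset v} {b} → (x ∈ S) ⇔ (b ≡ true) → lookup S x ≡ b
∈⇔⇒lookup≡ {b = true} x∈S⇔ = []=⇒lookup (Equivalence.from x∈S⇔ refl)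
∈⇔⇒lookup≡ {x = x} {S} {false} x∈S⇔ with lookup S x in S[x]
... | false = refl
... | true  = sym (Equivalence.to x∈S⇔ (lookup⇒[]= x S S[x]))

⊕-sum-cong : ∀ {r} {f g : Fin r → Bool} → (∀ i → f i ≡ g i) → ⊕-sum f ≡ ⊕-sum g
⊕-sum-cong {zero}  _   = refl
⊕-sum-cong {suc r} f≗g = cong₂ _xor_ (f≗g zero) (⊕-sum-cong (f≗g ∘ suc))

filter-length-≡⇒⊇ : ∀ {A : Set} {P Q : A → Set} (P? : Decidable P) (Q? : Decidable Q) →
                    (∀ {a} → P a → Q a) → ∀ xs → length (filter P? xs) ≡ length (filter Q? xs) →
                    ∀ {a} → a ∈ₗ xs → Q a → P a
filter-length-≡⇒⊇ P? Q? P⇒Q xs same-length {a} a∈xs Qa =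
  proj₂ (∈-filter⁻ P? {xs = xs} (subst (a ∈ₗ_) (sym filters≡) (∈-filter⁺ Q? a∈xs Qa)))
  where
  filters≡ : filter P? xs ≡ filter Q? xs
  filters≡ = Pointwise-≡⇒≡ (to-≋ same-length (filter⁺ P? Q? {as = xs} (λ { refl → P⇒Q }) ⊆-refl))

0<length⇒∃∈ : ∀ {A : Set} {xs : List A} → 0 < length xs → ∃ λ a → a ∈ₗ xs
0<length⇒∃∈ {xs = a ∷ _} _ = a , here refl

another-point : ∀ {v} → 2 ≤ v → (x : Fin v) → ∃ λ y → y ≢ x
another-point (s≤s (s≤s z≤n)) zero    = suc zero , λ ()
another-point (s≤s (s≤s z≤n)) (suc x) = zero , λ ()

⟦_⟧ : Bool → ℕ
⟦ false ⟧ = 0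
⟦ true  ⟧ = 1

count : ∀ {m} → (Vec Bool m → Bool) → ℕ
count {zero}  f = ⟦ f [] ⟧
count {suc m} f = count (f ∘ (false ∷_)) + count (f ∘ (true ∷_))

count-cong : ∀ {m} {f g : Vec Bool m → Bool} → (∀ y → f y ≡ g y) → count f ≡ count g
count-cong {zero}  f≗g = cong ⟦_⟧ (f≗g [])
count-cong {suc m} f≗g = cong₂ _+_ (count-cong (f≗g ∘ (false ∷_))) (count-cong (f≗g ∘ (true ∷_)))

count-false : ∀ m → count {m} (const false) ≡ 0
count-false zero    = refl
count-false (suc m) = cong₂ _+_ (count-false m) (count-false m)

count-+ : ∀ {m} {f g h k : Vec Bool m → Bool} →
          (∀ y → ⟦ f y ⟧ + ⟦ g y ⟧ ≡ ⟦ h y ⟧ + ⟦ k y ⟧) →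
          count f + count g ≡ count h + count k
count-+ {zero}  eq = eq []
count-+ {suc m} {f} {g} {h} {k} eq = begin
  (f₀ + f₁) + (g₀ + g₁) ≡⟨ interchange f₀ f₁ g₀ g₁ ⟩
  (f₀ + g₀) + (f₁ + g₁) ≡⟨ cong₂ _+_ (count-+ (eq ∘ (false ∷_))) (count-+ (eq ∘ (true ∷_))) ⟩
  (h₀ + k₀) + (h₁ + k₁) ≡⟨ interchange h₀ h₁ k₀ k₁ ⟨
  (h₀ + h₁) + (k₀ + k₁) ∎
  where
  open CommutativeSemigroupProperties +-commutativeSemigroup using (interchange)
  f₀ f₁ g₀ g₁ h₀ h₁ k₀ k₁ : ℕ
  f₀ = count (f ∘ (false ∷_)); f₁ = count (f ∘ (true ∷_))
  g₀ = count (g ∘ (false ∷_)); g₁ = count (g ∘ (true ∷_))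
  h₀ = count (h ∘ (false ∷_)); h₁ = count (h ∘ (true ∷_))
  k₀ = count (k ∘ (false ∷_)); k₁ = count (k ∘ (true ∷_))

⟦⟧≤count : ∀ {m} (f : Vec Bool m → Bool) y → ⟦ f y ⟧ ≤ count f
⟦⟧≤count f []          = ≤-refl
⟦⟧≤count f (false ∷ y) = ≤-trans (⟦⟧≤count (f ∘ (false ∷_)) y) (m≤m+n _ _)
⟦⟧≤count f (true  ∷ y) = ≤-trans (⟦⟧≤count (f ∘ (true ∷_)) y) (m≤n+m _ _)

isNonzero : ∀ {m} → Vec Bool m → Bool
isNonzero []      = false
isNonzero (b ∷ y) = b ∨ isNonzero y

0̂ : ∀ {m} → Vec Bool m
0̂ {m} = replicate m false

isNonzero-0̂ : ∀ m → isNonzero (0̂ {m}) ≡ false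
isNonzero-0̂ zero    = refl
isNonzero-0̂ (suc m) = isNonzero-0̂ m

isNonzero⊎≡0̂ : ∀ {m} (y : Vec Bool m) → isNonzero y ≡ true ⊎ y ≡ 0̂
isNonzero⊎≡0̂ []          = inj₂ refl
isNonzero⊎≡0̂ (true  ∷ y) = inj₁ refl
isNonzero⊎≡0̂ (false ∷ y) with isNonzero⊎≡0̂ y
... | inj₁ y≢0 = inj₁ y≢0
... | inj₂ y≡0 = inj₂ (cong (false ∷_) y≡0)

nonzero⇔isNonzero : ∀ {m} (y : Vec Bool m) → nonzero y ⇔ (isNonzero y ≡ true)
nonzero⇔isNonzero {m} y = mk⇔ to from
  where
  to : nonzero y → isNonzero y ≡ true
  to y≢0 with isNonzero⊎≡0̂ y
  ... | inj₁ y≢0′ = y≢0′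
  ... | inj₂ y≡0  = ⊥-elim (y≢0 y≡0)
  from : isNonzero y ≡ true → nonzero y
  from y≢0 refl with () ← trans (sym y≢0) (isNonzero-0̂ m)

extend-from-nonzero : ∀ {m} {f : Vec Bool m → Bool} {b : Bool} →
                      (∀ y → isNonzero y ≡ true → f y ≡ b) → f 0̂ ≡ b → ∀ y → f y ≡ b
extend-from-nonzero f≡b f0≡b y with isNonzero⊎≡0̂ y
... | inj₁ y≢0 = f≡b y y≢0
... | inj₂ refl = f0≡b

count-cong-nonzero : ∀ {m} {f g : Vec Bool m → Bool} → (∀ y → isNonzero y ≡ true → f y ≡ g y) →
                     count f + ⟦ g 0̂ ⟧ ≡ count g + ⟦ f 0̂ ⟧
count-cong-nonzero {zero}  {f} {g} _ = +-comm ⟦ f [] ⟧ ⟦ g [] ⟧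
count-cong-nonzero {suc m} {f} {g} f≗g = begin
  (f₀ + f₁) + ⟦ g 0̂ ⟧ ≡⟨ +-assoc f₀ f₁ _ ⟩
  f₀ + (f₁ + ⟦ g 0̂ ⟧) ≡⟨ cong (f₀ +_) (+-comm f₁ _) ⟩
  f₀ + (⟦ g 0̂ ⟧ + f₁) ≡⟨ +-assoc f₀ _ f₁ ⟨
  (f₀ + ⟦ g 0̂ ⟧) + f₁ ≡⟨ cong₂ _+_ (count-cong-nonzero (f≗g ∘ (false ∷_)))
                                   (count-cong (λ y → f≗g (true ∷ y) refl)) ⟩
  (g₀ + ⟦ f 0̂ ⟧) + g₁ ≡⟨ +-assoc g₀ _ g₁ ⟩
  g₀ + (⟦ f 0̂ ⟧ + g₁) ≡⟨ cong (g₀ +_) (+-comm _ g₁) ⟩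
  g₀ + (g₁ + ⟦ f 0̂ ⟧) ≡⟨ +-assoc g₀ g₁ _ ⟨
  (g₀ + g₁) + ⟦ f 0̂ ⟧ ∎
  where
  f₀ f₁ g₀ g₁ : ℕ
  f₀ = count (f ∘ (false ∷_)); f₁ = count (f ∘ (true ∷_))
  g₀ = count (g ∘ (false ∷_)); g₁ = count (g ∘ (true ∷_))

dot-zeroˡ : ∀ {m} (y : Vec Bool m) → dot 0̂ y ≡ false
dot-zeroˡ []      = refl
dot-zeroˡ (_ ∷ y) = dot-zeroˡ y

dot-zeroʳ : ∀ {m} (a : Vec Bool m) → dot a 0̂ ≡ false
dot-zeroʳ []      = refl
dot-zeroʳ (α ∷ a) = cong₂ _xor_ (∧-zeroʳ α) (dot-zeroʳ a)

dot-distribʳ-Δ : ∀ {m} (a b y : Vec Bool m) → dot (a Δ b) y ≡ dot a y xor dot b y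
dot-distribʳ-Δ []      []      []      = refl
dot-distribʳ-Δ (α ∷ a) (β ∷ b) (t ∷ y) = begin
  ((α xor β) ∧ t) xor dot (a Δ b) y              ≡⟨ cong₂ _xor_ (∧-distribʳ-xor t α β) (dot-distribʳ-Δ a b y) ⟩
  ((α ∧ t) xor (β ∧ t)) xor (dot a y xor dot b y) ≡⟨ interchange (α ∧ t) (β ∧ t) (dot a y) (dot b y) ⟩
  ((α ∧ t) xor dot a y) xor ((β ∧ t) xor dot b y) ∎
  where
  open CommutativeSemigroupProperties (CommutativeRing.+-commutativeSemigroup xor-∧-commutativeRing) using (interchange)

count-dot≡count-not-dot : ∀ {m} (a : Vec Bool m) → isNonzero a ≡ true →
                          count (dot a) ≡ count (not ∘ dot a)
count-dot≡count-not-dot (false ∷ a) a≢0 =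
  cong₂ _+_ (count-dot≡count-not-dot a a≢0) (count-dot≡count-not-dot a a≢0)
count-dot≡count-not-dot (true ∷ a) _ = begin
  count (dot a) + count (not ∘ dot a)             ≡⟨ +-comm (count (dot a)) _ ⟩
  count (not ∘ dot a) + count (dot a)
    ≡⟨ cong (count (not ∘ dot a) +_) (count-cong (λ y → sym (not-involutive (dot a y)))) ⟩
  count (not ∘ dot a) + count (not ∘ not ∘ dot a) ∎

hits : ∀ {m} → (Vec Bool m → Bool) → Vec Bool m → ℕ
hits T a = count (λ y → T y ∧ dot a y)

misses : ∀ {m} → (Vec Bool m → Bool) → Vec Bool m → ℕ
misses T a = count (λ y → T y ∧ not (dot a y))

Equidistributed ContainsNonzero AvoidsNonzero : ∀ {m} → (Vec Bool m → Bool) → Set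
Equidistributed T = ∀ a b → isNonzero a ≡ true → isNonzero b ≡ true → hits T a ≡ hits T b
ContainsNonzero T = ∀ y → isNonzero y ≡ true → T y ≡ true
AvoidsNonzero   T = ∀ y → isNonzero y ≡ true → T y ≡ false

hits+misses : ∀ {m} (T : Vec Bool m → Bool) a → hits T a + misses T a ≡ count T
hits+misses {m} T a = begin
  hits T a + misses T a            ≡⟨ count-+ (λ y → split (T y) (dot a y)) ⟩
  count T + count {m} (const false) ≡⟨ cong (count T +_) (count-false m) ⟩
  count T + 0                      ≡⟨ +-identityʳ (count T) ⟩
  count T                          ∎
  where
  split : ∀ t d → ⟦ t ∧ d ⟧ + ⟦ t ∧ not d ⟧ ≡ ⟦ t ⟧ + 0
  split true  true  = refl
  split true  false = refl
  split false _     = refl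

hits-containsNonzero : ∀ {m} {T : Vec Bool m → Bool} → ContainsNonzero T → ∀ a → hits T a ≡ count (dot a)
hits-containsNonzero {m} {T} T⊇ a = +-cancelʳ-≡ _ _ _ (begin
  hits T a + ⟦ dot a 0̂ ⟧          ≡⟨ count-cong-nonzero (λ y y≢0 → cong (_∧ dot a y) (T⊇ y y≢0)) ⟩
  count (dot a) + ⟦ T 0̂ ∧ dot a 0̂ ⟧ ≡⟨ cong (λ d → count (dot a) + ⟦ T 0̂ ∧ d ⟧) (dot-zeroʳ a) ⟩
  count (dot a) + ⟦ T 0̂ ∧ false ⟧  ≡⟨ cong (λ d → count (dot a) + ⟦ d ⟧) (trans (∧-zeroʳ _) (sym (dot-zeroʳ a))) ⟩
  count (dot a) + ⟦ dot a 0̂ ⟧      ∎)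

hits-avoidsNonzero : ∀ {m} {T : Vec Bool m → Bool} → AvoidsNonzero T → ∀ a → hits T a ≡ 0
hits-avoidsNonzero {m} {T} T∩=∅ a =
  trans (count-cong (extend-from-nonzero {f = λ y → T y ∧ dot a y} T∧a≡false T∧a0≡false)) (count-false m)
  where
  T∧a≡false : ∀ y → isNonzero y ≡ true → T y ∧ dot a y ≡ false
  T∧a≡false y y≢0 = cong (_∧ dot a y) (T∩=∅ y y≢0)
  T∧a0≡false : T 0̂ ∧ dot a 0̂ ≡ false
  T∧a0≡false = trans (cong (T 0̂ ∧_) (dot-zeroʳ a)) (∧-zeroʳ (T 0̂))

⟦⟧-injective : ∀ {b c} → ⟦ b ⟧ ≡ ⟦ c ⟧ → b ≡ c
⟦⟧-injective {false} {false} _ = refl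
⟦⟧-injective {true}  {true}  _ = refl

-- With y = t ∷ y′, hits T (false ∷ a) = hits T₀ a + hits T₁ a and hits T (true ∷ a) = hits T₀ a + misses T₁ a
-- hold by computation; comparing both with hits T (true ∷ 0̂) = count T₁ gives the lemmas below.
module Halves {m} (T : Vec Bool (suc m) → Bool) (T-eq : Equidistributed T) where

  T₀ T₁ : Vec Bool m → Bool
  T₀ = T ∘ (false ∷_)
  T₁ = T ∘ (true ∷_)

  hits-T-first-unit : hits T (true ∷ 0̂) ≡ count T₁
  hits-T-first-unit = cong₂ _+_
    (trans (count-cong (λ y → trans (cong (T₀ y ∧_) (dot-zeroˡ y)) (∧-zeroʳ (T₀ y)))) (count-false m))
    (count-cong (λ y → trans (cong (λ d → T₁ y ∧ not d) (dot-zeroˡ y)) (∧-identityʳ (T₁ y))))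

  module _ (a : Vec Bool m) (a≢0 : isNonzero a ≡ true) where

    hits-T₀+hits-T₁ : hits T₀ a + hits T₁ a ≡ count T₁
    hits-T₀+hits-T₁ = trans (T-eq (false ∷ a) (true ∷ 0̂) a≢0 refl) hits-T-first-unit

    hits-T₀+misses-T₁ : hits T₀ a + misses T₁ a ≡ count T₁
    hits-T₀+misses-T₁ = trans (T-eq (true ∷ a) (true ∷ 0̂) refl refl) hits-T-first-unit

    hits-T₁≡misses-T₁ : hits T₁ a ≡ misses T₁ a
    hits-T₁≡misses-T₁ = +-cancelˡ-≡ (hits T₀ a) _ _ (trans hits-T₀+hits-T₁ (sym hits-T₀+misses-T₁))

    hits-T₀≡hits-T₁ : hits T₀ a ≡ hits T₁ a
    hits-T₀≡hits-T₁ = +-cancelʳ-≡ (hits T₁ a) _ _ (begin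
      hits T₀ a + hits T₁ a   ≡⟨ hits-T₀+hits-T₁ ⟩
      count T₁                ≡⟨ hits+misses T₁ a ⟨
      hits T₁ a + misses T₁ a ≡⟨ cong (hits T₁ a +_) hits-T₁≡misses-T₁ ⟨
      hits T₁ a + hits T₁ a   ∎)

    hits-T₁≡half : hits T₁ a ≡ ⌊ count T₁ /2⌋
    hits-T₁≡half = trans (n≡⌊n+n/2⌋ (hits T₁ a))
      (cong ⌊_/2⌋ (trans (cong (hits T₁ a +_) hits-T₁≡misses-T₁) (hits+misses T₁ a)))

  T₁-equidistributed : Equidistributed T₁
  T₁-equidistributed a b a≢0 b≢0 = trans (hits-T₁≡half a a≢0) (sym (hits-T₁≡half b b≢0))

  T₀-equidistributed : Equidistributed T₀
  T₀-equidistributed a b a≢0 b≢0 = begin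
    hits T₀ a ≡⟨ hits-T₀≡hits-T₁ a a≢0 ⟩
    hits T₁ a ≡⟨ T₁-equidistributed a b a≢0 b≢0 ⟩
    hits T₁ b ≡⟨ hits-T₀≡hits-T₁ b b≢0 ⟨
    hits T₀ b ∎

module Glue {m} (T : Vec Bool (suc (suc m)) → Bool) (T-eq : Equidistributed T) where
  open Halves T T-eq

  e₁ : Vec Bool (suc m)
  e₁ = true ∷ 0̂

  count-dot-e₁≢0 : count (dot e₁) ≢ 0
  count-dot-e₁≢0 =
    n>0⇒n≢0 (subst (_≤ count (dot e₁)) (cong (⟦_⟧ ∘ not) (dot-zeroˡ {m} 0̂)) (⟦⟧≤count (dot e₁) e₁))

  no-mixing : ∀ {U V} → ContainsNonzero U → AvoidsNonzero V → hits U e₁ ≢ hits V e₁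
  no-mixing U⊇ V∩=∅ U≡V =
    count-dot-e₁≢0 (trans (sym (hits-containsNonzero U⊇ e₁)) (trans U≡V (hits-avoidsNonzero V∩=∅ e₁)))

  T₁-0̂-false : AvoidsNonzero T₁ → T₁ 0̂ ≡ false
  T₁-0̂-false T₁∩=∅ = ⟦⟧-injective (begin
    ⟦ T₁ 0̂ ⟧                            ≡⟨ cong (_+ ⟦ T₁ 0̂ ⟧) (count-false (suc m)) ⟨
    count {suc m} (const false) + ⟦ T₁ 0̂ ⟧ ≡⟨ count-cong-nonzero {f = T₁} {g = const false} T₁∩=∅ ⟨
    count T₁ + 0                        ≡⟨ +-identityʳ (count T₁) ⟩
    count T₁                            ≡⟨ hits+misses T₁ e₁ ⟨
    hits T₁ e₁ + misses T₁ e₁           ≡⟨ cong (hits T₁ e₁ +_) (hits-T₁≡misses-T₁ e₁ refl) ⟨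
    hits T₁ e₁ + hits T₁ e₁             ≡⟨ cong (λ h → h + h) (hits-avoidsNonzero T₁∩=∅ e₁) ⟩
    0                                   ∎)

  -- misses T₁ e₁ = hits T₁ e₁ = count (dot e₁) = count (not ∘ dot e₁), and the last set contains 0̂.
  T₁-0̂-true : ContainsNonzero T₁ → T₁ 0̂ ≡ true
  T₁-0̂-true T₁⊇ = ⟦⟧-injective (+-cancelˡ-≡ (count (not ∘ dot e₁)) _ _ (begin
    count (not ∘ dot e₁) + ⟦ T₁ 0̂ ⟧
      ≡⟨ cong (λ b → count (not ∘ dot e₁) + ⟦ b ⟧) (off-e₁ (T₁ 0̂)) ⟨
    count (not ∘ dot e₁) + ⟦ T₁ 0̂ ∧ not (dot e₁ 0̂) ⟧
      ≡⟨ count-cong-nonzero {f = λ y → T₁ y ∧ not (dot e₁ y)} {g = not ∘ dot e₁}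
                            (λ y y≢0 → cong (_∧ not (dot e₁ y)) (T₁⊇ y y≢0)) ⟨
    misses T₁ e₁ + ⟦ not (dot e₁ 0̂) ⟧
      ≡⟨ cong₂ _+_ misses-T₁≡count-not (cong ⟦_⟧ (off-e₁ true)) ⟩
    count (not ∘ dot e₁) + ⟦ true ⟧
      ∎))
    where
    off-e₁ : ∀ b → b ∧ not (dot e₁ 0̂) ≡ b
    off-e₁ b = trans (cong (λ d → b ∧ not d) (dot-zeroʳ e₁)) (∧-identityʳ b)
    misses-T₁≡count-not : misses T₁ e₁ ≡ count (not ∘ dot e₁)
    misses-T₁≡count-not = begin
      misses T₁ e₁         ≡⟨ hits-T₁≡misses-T₁ e₁ refl ⟨
      hits T₁ e₁           ≡⟨ hits-containsNonzero T₁⊇ e₁ ⟩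
      count (dot e₁)       ≡⟨ count-dot≡count-not-dot e₁ refl ⟩
      count (not ∘ dot e₁) ∎

  glue : ContainsNonzero T₀ ⊎ AvoidsNonzero T₀ → ContainsNonzero T₁ ⊎ AvoidsNonzero T₁ →
         ContainsNonzero T ⊎ AvoidsNonzero T
  glue (inj₁ T₀⊇) (inj₂ T₁∩=∅) = ⊥-elim (no-mixing T₀⊇ T₁∩=∅ (hits-T₀≡hits-T₁ e₁ refl))
  glue (inj₂ T₀∩=∅) (inj₁ T₁⊇) = ⊥-elim (no-mixing T₁⊇ T₀∩=∅ (sym (hits-T₀≡hits-T₁ e₁ refl)))
  glue (inj₁ T₀⊇) (inj₁ T₁⊇) = inj₁ λ
    { (false ∷ y) y≢0 → T₀⊇ y y≢0
    ; (true ∷ y) _    → extend-from-nonzero T₁⊇ (T₁-0̂-true T₁⊇) y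
    }
  glue (inj₂ T₀∩=∅) (inj₂ T₁∩=∅) = inj₂ λ
    { (false ∷ y) y≢0 → T₀∩=∅ y y≢0
    ; (true ∷ y) _    → extend-from-nonzero T₁∩=∅ (T₁-0̂-false T₁∩=∅) y
    }

equidistributed⇒contains⊎avoids : ∀ {m} (T : Vec Bool m → Bool) → Equidistributed T →
                                  ContainsNonzero T ⊎ AvoidsNonzero T
equidistributed⇒contains⊎avoids {zero} T _ = inj₁ λ { [] () }
equidistributed⇒contains⊎avoids {suc zero} T _ with T (true ∷ []) in T-e₀
... | true  = inj₁ λ { (true ∷ []) _ → T-e₀ ; (false ∷ []) () }
... | false = inj₂ λ { (true ∷ []) _ → T-e₀ ; (false ∷ []) () }
equidistributed⇒contains⊎avoids {suc (suc m)} T T-eq =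
  glue (equidistributed⇒contains⊎avoids T₀ T₀-equidistributed)
       (equidistributed⇒contains⊎avoids T₁ T₁-equidistributed)
  where open Halves T T-eq using (T₀; T₁; T₀-equidistributed; T₁-equidistributed)
        open Glue T T-eq using (glue)

_≟ᵥ_ : ∀ {m} → DecidableEquality (Vec Bool m)
_≟ᵥ_ = ≡-dec _≟ᵇ_

count-singleton : ∀ {m} (y₀ : Vec Bool m) (p : Vec Bool m → Bool) →
                  count (λ y → does (y₀ ≟ᵥ y) ∧ p y) ≡ ⟦ p y₀ ⟧
count-singleton []               p = refl
count-singleton {suc m} (false ∷ y₀) p =
  trans (cong₂ _+_ (count-singleton y₀ (p ∘ (false ∷_))) (count-false m)) (+-identityʳ _)
count-singleton {suc m} (true  ∷ y₀) p =
  cong₂ _+_ (count-false m) (count-singleton y₀ (p ∘ (true ∷_)))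

inImage : ∀ {v m} → (Fin v → Vec Bool m) → Vec Bool m → Bool
inImage φ y = does (any? (λ x → φ x ≟ᵥ y))

inImage-sound : ∀ {v m} (φ : Fin v → Vec Bool m) {y} → inImage φ y ≡ true → ∃ λ x → φ x ≡ y
inImage-sound φ {y} y∈ with any? (λ x → φ x ≟ᵥ y)
... | yes found = found

inImage-complete : ∀ {v m} (φ : Fin v → Vec Bool m) x → inImage φ (φ x) ≡ true
inImage-complete φ x = dec-true (any? (λ x′ → φ x′ ≟ᵥ φ x)) (x , refl)

∣∷∣ : ∀ {v} s (S : Subset v) → ∣ s ∷ S ∣ ≡ ⟦ s ⟧ + ∣ S ∣
∣∷∣ false S = refl
∣∷∣ true  S = refl

count-image : ∀ {v m} (φ : Fin v → Vec Bool m) → Injective _≡_ _≡_ φ →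
              (p : Vec Bool m → Bool) (S : Subset v) → (∀ x → lookup S x ≡ p (φ x)) →
              count (λ y → inImage φ y ∧ p y) ≡ ∣ S ∣
count-image {m = m} φ φ-inj p []      _    = count-false m
count-image {m = m} φ φ-inj p (s ∷ S) S≡pφ = begin
  count (λ y → inImage φ y ∧ p y)
    ≡⟨ trans (cong (count (λ y → inImage φ y ∧ p y) +_) (count-false m)) (+-identityʳ _) ⟨
  count (λ y → inImage φ y ∧ p y) + count {m} (const false)
    ≡⟨ count-+ (λ y → disjoint (φ zero ≟ᵥ y) (p y) (apart y)) ⟩
  count (λ y → does (φ zero ≟ᵥ y) ∧ p y) + count (λ y → inImage (φ ∘ suc) y ∧ p y)
    ≡⟨ cong₂ _+_ (count-singleton (φ zero) p) (count-image (φ ∘ suc) (suc-injective ∘ φ-inj) p S (S≡pφ ∘ suc)) ⟩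
  ⟦ p (φ zero) ⟧ + ∣ S ∣
    ≡⟨ cong (λ b → ⟦ b ⟧ + ∣ S ∣) (S≡pφ zero) ⟨
  ⟦ s ⟧ + ∣ S ∣
    ≡⟨ ∣∷∣ s S ⟨
  ∣ s ∷ S ∣
    ∎
  where
  apart : ∀ y → φ zero ≡ y → ¬ (inImage (φ ∘ suc) y ≡ true)
  apart y φ0≡y y∈ with x , φx≡y ← inImage-sound (φ ∘ suc) y∈ = 0≢1+n (φ-inj (trans φ0≡y (sym φx≡y)))
  disjoint : ∀ {A : Set} (a? : Dec A) {r} t → (A → ¬ (r ≡ true)) →
             ⟦ (does a? ∨ r) ∧ t ⟧ + 0 ≡ ⟦ does a? ∧ t ⟧ + ⟦ r ∧ t ⟧
  disjoint (no _)  {r} t _ = +-identityʳ ⟦ r ∧ t ⟧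
  disjoint (yes a) {false} t _ = refl
  disjoint (yes a) {true}  t a→⊥ = ⊥-elim (a→⊥ a refl)

IsDependency : ∀ {m r} → (Fin r → Fin m → Bool) → Subset r → Set
IsDependency f c = (∀ i → ⊕-sum (λ l → lookup c l ∧ f l i) ≡ false) × Nonempty c

isDependency? : ∀ {m r} (f : Fin r → Fin m → Bool) → Decidable (IsDependency f)
isDependency? f c = all? (λ i → ⊕-sum (λ l → lookup c l ∧ f l i) ≟ᵇ false) ×-dec nonempty? c

¬LinIndep⇒dependency : ∀ {m r} (f : Fin r → Fin m → Bool) → ¬ LinIndep f → ∃ (IsDependency f)
¬LinIndep⇒dependency f ¬indep with anySubset? (isDependency? f)
... | yes dependency = dependency
... | no ¬dependency = ⊥-elim (¬indep indep)
  where
  indep : LinIndep f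
  indep c sum≡0 l with c l in c[l]
  ... | false = refl
  ... | true  = ⊥-elim (¬dependency (tabulate c , relation , l , l∈c))
    where
    relation : ∀ i → ⊕-sum (λ l → lookup (tabulate c) l ∧ f l i) ≡ false
    relation i = trans (⊕-sum-cong (λ l → cong (_∧ f l i) (lookup∘tabulate c l))) (sum≡0 i)
    l∈c : l ∈ tabulate c
    l∈c = lookup⇒[]= l (tabulate c) (trans (lookup∘tabulate c l) c[l])

combination : ∀ {v b r} → (Fin b → Subset v) → (Fin r → Fin b) → (Fin r → Bool) → Fin v → Bool
combination B h c x = ⊕-sum (λ l → c l ∧ lookup (B (h l)) x)

combination-closed : ∀ {v b} {B : Fin b → Subset v} → ClosedUnderΔ B →
                     ∀ {r} (h : Fin r → Fin b) (c : Fin r → Bool) →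
                     (∀ x → combination B h c x ≡ false) ⊎ ∃ λ j → ∀ x → combination B h c x ≡ lookup (B j) x
combination-closed closed {zero} h c = inj₁ λ _ → refl
combination-closed {B = B} closed {suc r} h c with c zero | combination-closed closed (h ∘ suc) (c ∘ suc)
... | false | rest = rest
... | true  | inj₁ rest≡0 = inj₂ (h zero , λ x → trans (cong (lookup (B (h zero)) x xor_) (rest≡0 x)) (xor-identityʳ _))
... | true  | inj₂ (j , rest≡Bj) =
  Sum.map (λ Δ≡⊥ x → trans (Δ-step x) (trans (cong (λ S → lookup S x) Δ≡⊥) (lookup-replicate x false)))
          (λ (l , Δ≡Bl) → l , λ x → trans (Δ-step x) (cong (λ S → lookup S x) Δ≡Bl))
          (closed (h zero) j)
  where
  Δ-step : ∀ x → lookup (B (h zero)) x xor combination B (h ∘ suc) (c ∘ suc) x ≡ lookup (B (h zero) Δ B j) x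
  Δ-step x = trans (cong (lookup (B (h zero)) x xor_) (rest≡Bj x)) (sym (lookup-Δ (B (h zero)) (B j) x))

module _ {v k lam b} {B : Fin b → Subset v} (bibd : IsSimpleBIBD v k lam b B) where
  open IsSimpleBIBD bibd

  2≤v : 2 ≤ v
  2≤v = ≤-trans 2≤k (<⇒≤ k<v)

  k≢0 : k ≢ 0
  k≢0 = n>0⇒n≢0 (≤-trans (s≤s z≤n) 2≤k)

  point-in-block : ∀ x → ∃ λ j → x ∈ B j
  point-in-block x with another-point 2≤v x
  ... | y , y≢x with 0<length⇒∃∈ (subst (0 <_) (sym (balanced x y (y≢x ∘ sym))) 1≤λ)
  ...   | j , j∈ = j , proj₁ (proj₂ (∈-filter⁻ (λ j → (x ∈? B j) ×-dec (y ∈? B j)) {xs = allFin b} j∈))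

  point-off-block : ∀ j → ∃ λ w → w ∉ B j
  point-off-block j = ¬∀⟶∃¬ v _ (_∈? B j) λ all∈ →
    <⇒≱ k<v (subst₂ _≤_ (∣⊤∣≡n v) (blockSize j) (p⊆q⇒∣p∣≤∣q∣ {p = ⊤} (λ {w} _ → all∈ w)))

  block-nonempty : ∀ j → Nonempty (B j)
  block-nonempty j with nonempty? (B j)
  ... | yes nonempty = nonempty
  ... | no  empty    = ⊥-elim (k≢0 (trans (sym (blockSize j)) (trans (cong ∣_∣ (Empty-unique empty)) (∣⊥∣≡0 v))))

  same-blocks⇒≡ : ∀ {x y} → (∀ j → x ∈ B j → y ∈ B j) → x ≡ y
  same-blocks⇒≡ {x} {y} x⇒y with x ≟ᶠ y | point-in-block x
  ... | yes x≡y | _ = x≡y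
  ... | no  x≢y | j₀ , x∈Bj₀ with point-off-block j₀
  ...   | w , w∉Bj₀ = ⊥-elim (w∉Bj₀ (proj₂ (filter-length-≡⇒⊇ (pair? w) (pair? y) (λ (x∈ , _) → x∈ , x⇒y _ x∈)
                                              (allFin b) same-pair-count (∈-allFin j₀) (x∈Bj₀ , x⇒y j₀ x∈Bj₀))))
    where
    pair? : ∀ z → Decidable (λ j → x ∈ B j × z ∈ B j)
    pair? z j = (x ∈? B j) ×-dec (z ∈? B j)
    same-pair-count : pairCount B x w ≡ pairCount B x y
    same-pair-count = trans (balanced x w (λ x≡w → w∉Bj₀ (subst (_∈ B j₀) x≡w x∈Bj₀))) (sym (balanced x y x≢y))

-- S is the preimage under φ of the block C_a = {y : a·y = 1} of the complementary design of PG(n-1,2).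
Represents : ∀ {v n} → (Fin v → Vec Bool n) → Vec Bool n → Subset v → Set
Represents φ a S = ∀ x → lookup S x ≡ dot a (φ x)

module _ {v n} (φ : Fin v → Vec Bool n) where

  represents-unique : ∀ {a S S′} → Represents φ a S → Represents φ a S′ → S ≡ S′
  represents-unique S≐ S′≐ = lookup-extensionality λ x → trans (S≐ x) (sym (S′≐ x))

  represents-0̂ : ∀ {S} → Represents φ 0̂ S → S ≡ ⊥
  represents-0̂ {S} S≐ =
    represents-unique {0̂} {S} {⊥} S≐ λ x → trans (lookup-replicate x false) (sym (dot-zeroˡ (φ x)))

  represents-Δ : ∀ {a a′ S S′} → Represents φ a S → Represents φ a′ S′ → Represents φ (a Δ a′) (S Δ S′)
  represents-Δ {a} {a′} {S} {S′} S≐ S′≐ x = begin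
    lookup (S Δ S′) x              ≡⟨ lookup-Δ S S′ x ⟩
    lookup S x xor lookup S′ x     ≡⟨ cong₂ _xor_ (S≐ x) (S′≐ x) ⟩
    dot a (φ x) xor dot a′ (φ x)   ≡⟨ dot-distribʳ-Δ a a′ (φ x) ⟨
    dot (a Δ a′) (φ x)             ∎

represented⇒⊥⊎block : ∀ {v b n} {B : Fin b → Subset v} (φ : Fin v → Vec Bool n) →
                      (∀ c → isNonzero c ≡ true → ∃ λ l → Represents φ c (B l)) →
                      ∀ c {S} → Represents φ c S → (S ≡ ⊥) ⊎ ∃ λ l → S ≡ B l
represented⇒⊥⊎block {B = B} φ nonzero⇒block c {S} S≐ with isNonzero⊎≡0̂ c
... | inj₂ refl = inj₁ (represents-0̂ φ S≐)
... | inj₁ c≢0̂ with l , Bl≐ ← nonzero⇒block c c≢0̂ = inj₂ (l , represents-unique φ {c} {S} {B l} S≐ Bl≐)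

IsoCompPG⇒ClosedUnderΔ : ∀ {v b} {B : Fin b → Subset v} {n} → IsoCompPG B n → ClosedUnderΔ B
IsoCompPG⇒ClosedUnderΔ {B = B} (φ , _ , _ , _ , block⇒hyperplane , hyperplane⇒block) i j
  with a , _ , Bi⇔ ← block⇒hyperplane i | a′ , _ , Bj⇔ ← block⇒hyperplane j =
  represented⇒⊥⊎block φ nonzero⇒block (a Δ a′)
    (represents-Δ φ {a} {a′} {B i} {B j} (∈⇔⇒lookup≡ ∘ Bi⇔) (∈⇔⇒lookup≡ ∘ Bj⇔))
  where
  nonzero⇒block : ∀ c → isNonzero c ≡ true → ∃ λ l → Represents φ c (B l)
  nonzero⇒block c c≢0̂ with l , Bl⇔ ← hyperplane⇒block c (Equivalence.from (nonzero⇔isNonzero c) c≢0̂) =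
    l , ∈⇔⇒lookup≡ ∘ Bl⇔

module FromClosure {v k lam b} {B : Fin b → Subset v} (bibd : IsSimpleBIBD v k lam b B)
                   (closed : ClosedUnderΔ B) {n} (rank : RankF2 (incidence B) n) where

  open IsSimpleBIBD bibd using (blockSize)

  basis : Fin n → Fin b
  basis = proj₁ (proj₁ rank)

  independent : LinIndep (λ l → column (incidence B) (basis l))
  independent = proj₂ (proj₁ rank)

  maximal : ∀ (g : Fin (suc n) → Fin b) → ¬ LinIndep (λ l → column (incidence B) (g l))
  maximal = proj₂ rank

  φ : Fin v → Vec Bool n
  φ x = tabulate (λ l → lookup (B (basis l)) x)

  combination-basis : ∀ a x → combination B basis (lookup a) x ≡ dot a (φ x)
  combination-basis a x = ⊕-sum-cong λ l → cong (lookup a l ∧_) (sym (lookup∘tabulate (λ l → lookup (B (basis l)) x) l))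

  -- The dependency given by maximality must involve B j, because the basis columns are independent.
  block-in-span : ∀ j → ∃ λ c → ∀ x → lookup (B j) x ≡ combination B basis (lookup c) x
  block-in-span j
    with ¬LinIndep⇒dependency (λ l → column (incidence B) ((j Vector.∷ basis) l)) (maximal (j Vector.∷ basis))
  ... | true  ∷ c , relation , _ = c , λ x → xor≡false⇒≡ (relation x)
  ... | false ∷ c , relation , zero , ()
  ... | false ∷ c , relation , suc l , there l∈c
    with () ← trans (sym ([]=⇒lookup l∈c)) (independent (lookup c) relation l)

  block-represented : ∀ j → ∃ λ a → isNonzero a ≡ true × Represents φ a (B j)
  block-represented j with c , Bj≡ ← block-in-span j = c , c≢0̂ , Bj≐
    where
    Bj≐ : Represents φ c (B j)
    Bj≐ x = trans (Bj≡ x) (combination-basis c x)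
    c≢0̂ : isNonzero c ≡ true
    c≢0̂ with isNonzero⊎≡0̂ c | block-nonempty bibd j
    ... | inj₁ c≢0̂ | _ = c≢0̂
    ... | inj₂ refl | x , x∈Bj with () ← trans (sym ([]=⇒lookup x∈Bj)) (trans (Bj≐ x) (dot-zeroˡ (φ x)))

  nonzero-represents-block : ∀ a → isNonzero a ≡ true → ∃ λ j → Represents φ a (B j)
  nonzero-represents-block a a≢0̂ with combination-closed closed basis (lookup a)
  ... | inj₂ (j , a≡Bj) = j , λ x → trans (sym (a≡Bj x)) (combination-basis a x)
  ... | inj₁ combination≡0 = ⊥-elim (Equivalence.from (nonzero⇔isNonzero a) a≢0̂ a≡0̂)
    where
    a≡0̂ : a ≡ 0̂
    a≡0̂ = lookup-extensionality λ l → trans (independent (lookup a) combination≡0 l) (sym (lookup-replicate l false))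

  φ-nonzero : ∀ x → isNonzero (φ x) ≡ true
  φ-nonzero x with point-in-block bibd x
  ... | j , x∈Bj with block-represented j | isNonzero⊎≡0̂ (φ x)
  ...   | _ , _ , _   | inj₁ φx≢0̂ = φx≢0̂
  ...   | a , _ , Bj≐ | inj₂ φx≡0̂
    with () ← trans (sym ([]=⇒lookup x∈Bj)) (trans (Bj≐ x) (trans (cong (dot a) φx≡0̂) (dot-zeroʳ a)))

  φ-injective : Injective _≡_ _≡_ φ
  φ-injective {x} {y} φx≡φy = same-blocks⇒≡ bibd x⇒y
    where
    x⇒y : ∀ j → x ∈ B j → y ∈ B j
    x⇒y j x∈Bj with a , _ , Bj≐ ← block-represented j =
      lookup⇒[]= y (B j) (trans (Bj≐ y) (trans (cong (dot a) (sym φx≡φy)) (trans (sym (Bj≐ x)) ([]=⇒lookup x∈Bj))))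

  image-equidistributed : Equidistributed (inImage φ)
  image-equidistributed a a′ a≢0̂ a′≢0̂ = trans (hits-image a a≢0̂) (sym (hits-image a′ a′≢0̂))
    where
    hits-image : ∀ a → isNonzero a ≡ true → hits (inImage φ) a ≡ k
    hits-image a a≢0̂ with j , Bj≐ ← nonzero-represents-block a a≢0̂ =
      trans (count-image φ φ-injective (dot a) (B j) Bj≐) (blockSize j)

  x₀ : Fin v
  x₀ = fromℕ< (≤-trans (s≤s z≤n) (2≤v bibd))

  φ-surjective : ∀ y → isNonzero y ≡ true → ∃ λ x → φ x ≡ y
  φ-surjective y y≢0̂ with equidistributed⇒contains⊎avoids (inImage φ) image-equidistributed
  ... | inj₁ image⊇ = inImage-sound φ (image⊇ y y≢0̂)
  ... | inj₂ image∩=∅ with () ← trans (sym (inImage-complete φ x₀)) (image∩=∅ (φ x₀) (φ-nonzero x₀))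

  isoCompPG : IsoCompPG B n
  isoCompPG =
      φ
    , (λ x → from (φ x) (φ-nonzero x))
    , φ-injective
    , (λ y y≢0̂ → φ-surjective y (to y y≢0̂))
    , (λ j → let a , a≢0̂ , Bj≐ = block-represented j in a , from a a≢0̂ , λ x → lookup≡⇒∈⇔ (Bj≐ x))
    , (λ a a≢0̂ → let j , Bj≐ = nonzero-represents-block a (to a a≢0̂) in j , λ x → lookup≡⇒∈⇔ (Bj≐ x))
    where
    to : ∀ y → nonzero y → isNonzero y ≡ true
    to y = Equivalence.to (nonzero⇔isNonzero y)
    from : ∀ y → isNonzero y ≡ true → nonzero y
    from y = Equivalence.from (nonzero⇔isNonzero y)

corollary1 : (v k lam b : ℕ) (B : Fin b → Subset v) →
    IsSimpleBIBD v k lam b B →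
    (n : ℕ) → RankF2 (incidence B) n →
    ClosedUnderΔ B ⇔ IsoCompPG B n
corollary1 v k lam b B bibd n rank =
  mk⇔ (λ closed → FromClosure.isoCompPG bibd closed rank) IsoCompPG⇒ClosedUnderΔ
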